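{- Let $m\ge2$ and $n\ge3$ be integers. Then (1) $\mathrm{inspc}(H^{(1)}_{m,n})\ge\lceil\frac{m+1}{2}\rceil$; (2) $\mathrm{inspc}(H^{(2)}_{m,n})\ge\lceil\frac{m+1}{2}\rceil$; (3) $\mathrm{inspc}(H^{(3)}_{m,n})\ge m$; (4) $\mathrm{inspp}(H^{(4)}_{m,n})\ge m$; (5) $\mathrm{inspp}(H^{(5)}_{m,n})\ge m$.
   Context: An induced SP-cover of a graph $G$ is a family of induced subgraphs of $G$, each isomorphic to a star $K_{1,k}$ ($k\ge1$) or a path $P_k$ ($k\ge1$), whose vertex sets cover $V(G)$; an induced SP-partition additionally has pairwise vertex-disjoint members; $\mathrm{inspc}(G)$, $\mathrm{inspp}(G)$ are the minimum cardinalities. Let $Q_i=u^{(1)}_iu^{(2)}_i\cdots u^{(n)}_i$ ($1\le i\le m$) be $m$ pairwise vertex-disjoint paths. $H^{(1)}_{m,n}$: the union of $Q_1,\dots,Q_m$ plus new vertices $v_i,w_i$ ($1\le i\le m-1$) and edges $v_iw_i,\ v_iu^{(n)}_i,\ v_iu^{(1)}_{i+1}$ ($1\le i\le m-1$). $H^{(2)}_{m,n}$: the union of $Q_1,\dots,Q_m$ plus new vertices $v_i$ ($1\le i\le m-1$) and edges $v_iu^{(n)}_i,\ v_iu^{(1)}_{i+1},\ u^{(n)}_iu^{(1)}_{i+1}$ ($1\le i\le m-1$). $H^{(3)}_{m,n}$: the union of $Q_1,\dots,Q_m$ plus new vertices $v_{i,j}$ ($1\le i\le m-1$, $1\le j\le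 m$) and edges $v_{i,j}u^{(n)}_i,\ v_{i,j}u^{(1)}_{i+1}$. $H^{(4)}_{m,n}$: $H^{(3)}_{m,n}$ with the vertices $v_{i,j}$ ($1\le i\le m-1$, $3\le j\le m$) deleted. $H^{(5)}_{m,n}$: $H^{(4)}_{m,n}$ plus the edges $v_{i,1}v_{i,2}$ ($1\le i\le m-1$). -}

module Defs where

open import Data.Nat using (ℕ; zero; suc; _∸_; _≤_; _<_)
open import Data.Fin using (Fin; toℕ)
open import Data.Product using (Σ; ∃; _×_; _,_)
open import Data.Sum using (_⊎_)
open import Data.Unit using (⊤)
open import Relation.Binary.PropositionalEquality using (_≡_)
open import Function.Definitions using (Injective)

record Graph : Set₁ where
  field
    V   : Set
    Adj : V → V → Set
open Graph public

Sym : {A : Set} → (A → A → Set) → A → A → Set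
Sym E x y = E x y ⊎ E y x

Star : ℕ → Graph
Star k = record { V = Fin (suc k) ; Adj = Sym StarE }
  where
  StarE : Fin (suc k) → Fin (suc k) → Set
  StarE a b = (toℕ a ≡ 0) × (0 < toℕ b)

Path : ℕ → Graph
Path k = record { V = Fin k ; Adj = Sym (λ a b → suc (toℕ a) ≡ toℕ b) }

record InducedCopy (G H : Graph) : Set where
  field
    emb      : V H → V G
    emb-inj  : Injective _≡_ _≡_ emb
    emb-pres : ∀ a b → Adj H a b → Adj G (emb a) (emb b)
    emb-refl : ∀ a b → Adj G (emb a) (emb b) → Adj H a b
open InducedCopy public

data SP (G : Graph) : Set where
  star : (k : ℕ) → 1 ≤ k → InducedCopy G (Star k) → SP G
  path : (k : ℕ) → 1 ≤ k → InducedCopy G (Path k) → SP G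

_∈SP_ : {G : Graph} → V G → SP G → Set
x ∈SP star k _ c = ∃ λ a → emb c a ≡ x
x ∈SP path k _ c = ∃ λ a → emb c a ≡ x

record SPCover (G : Graph) (t : ℕ) : Set where
  field
    member : Fin t → SP G
    covers : ∀ x → ∃ λ i → x ∈SP member i

record SPPartition (G : Graph) (t : ℕ) : Set where
  field
    member   : Fin t → SP G
    covers   : ∀ x → ∃ λ i → x ∈SP member i
    disjoint : ∀ i j x → x ∈SP member i → x ∈SP member j → i ≡ j

InspcAtLeast : Graph → ℕ → Set
InspcAtLeast G b = ∀ t → SPCover G t → b ≤ t

InsppAtLeast : Graph → ℕ → Set
InsppAtLeast G b = ∀ t → SPPartition G t → b ≤ t

-- The graphs H^(1..5)_{m,n}.
-- u i j  stands for u^{(j+1)}_{i+1}  (i : Fin m, j : Fin n), i.e. indices shifted to start at 0.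
-- Indices of v, w range over Fin (m ∸ 1), i.e. i = 0..m-2 stands for 1..m-1.

-- edges of the path Q_i : u i j — u i (j+1)
-- "u i j is the last vertex" : suc (toℕ j) ≡ n ; "first vertex" : toℕ j ≡ 0

data V1 (m n : ℕ) : Set where
  u : Fin m → Fin n → V1 m n
  v : Fin (m ∸ 1) → V1 m n
  w : Fin (m ∸ 1) → V1 m n

data E1 (m n : ℕ) : V1 m n → V1 m n → Set where
  path : ∀ i j j' → suc (toℕ j) ≡ toℕ j' → E1 m n (u i j) (u i j')
  vw   : ∀ i → E1 m n (v i) (w i)
  vlast : ∀ i i' j → toℕ i' ≡ toℕ i → suc (toℕ j) ≡ n → E1 m n (v i) (u i' j)
  vfirst : ∀ i i' j → toℕ i' ≡ suc (toℕ i) → toℕ j ≡ 0 → E1 m n (v i) (u i' j)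

H1 : ℕ → ℕ → Graph
H1 m n = record { V = V1 m n ; Adj = Sym (E1 m n) }

data V2 (m n : ℕ) : Set where
  u : Fin m → Fin n → V2 m n
  v : Fin (m ∸ 1) → V2 m n

data E2 (m n : ℕ) : V2 m n → V2 m n → Set where
  path : ∀ i j j' → suc (toℕ j) ≡ toℕ j' → E2 m n (u i j) (u i j')
  vlast : ∀ i i' j → toℕ i' ≡ toℕ i → suc (toℕ j) ≡ n → E2 m n (v i) (u i' j)
  vfirst : ∀ i i' j → toℕ i' ≡ suc (toℕ i) → toℕ j ≡ 0 → E2 m n (v i) (u i' j)
  uu : ∀ i i' j j' → toℕ i' ≡ suc (toℕ i) → suc (toℕ j) ≡ n → toℕ j' ≡ 0
       → E2 m n (u i j) (u i' j')

H2 : ℕ → ℕ → Graph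
H2 m n = record { V = V2 m n ; Adj = Sym (E2 m n) }

-- v i k stands for v_{i+1,k+1}
data V3 (m n : ℕ) : Set where
  u : Fin m → Fin n → V3 m n
  v : Fin (m ∸ 1) → Fin m → V3 m n

data E3 (m n : ℕ) : V3 m n → V3 m n → Set where
  path : ∀ i j j' → suc (toℕ j) ≡ toℕ j' → E3 m n (u i j) (u i j')
  vlast : ∀ i k i' j → toℕ i' ≡ toℕ i → suc (toℕ j) ≡ n → E3 m n (v i k) (u i' j)
  vfirst : ∀ i k i' j → toℕ i' ≡ suc (toℕ i) → toℕ j ≡ 0 → E3 m n (v i k) (u i' j)

H3 : ℕ → ℕ → Graph
H3 m n = record { V = V3 m n ; Adj = Sym (E3 m n) }

-- vertices kept in H^(4): all except v_{i,j} with j ≥ 3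
Keep4 : {m n : ℕ} → V3 m n → Set
Keep4 (u _ _) = ⊤
Keep4 (v _ k) = toℕ k < 2

H4 : ℕ → ℕ → Graph
H4 m n = record { V = Σ (V3 m n) Keep4
                ; Adj = λ x y → Sym (E3 m n) (Σ.proj₁ x) (Σ.proj₁ y) }

data E5extra (m n : ℕ) : V3 m n → V3 m n → Set where
  vv : ∀ i k k' → toℕ k ≡ 0 → toℕ k' ≡ 1 → E5extra m n (v i k) (v i k')

H5 : ℕ → ℕ → Graph
H5 m n = record { V = Σ (V3 m n) Keep4
                ; Adj = λ x y → Sym (E3 m n) (Σ.proj₁ x) (Σ.proj₁ y)
                              ⊎ Sym (E5extra m n) (Σ.proj₁ x) (Σ.proj₁ y) }

-- Induced stars and paths are connected, triangle-free and C₄-free; an induced path containing two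
-- twins has at most three vertices, so a member containing two twins lies within distance two of
-- them; and a simplicial vertex of the host graph is never interior to an induced path, so two
-- simplicial vertices of a member, neither of them the first vertex or centre, share a neighbour.
--
-- (1), (2): u¹₁, uⁿₘ and the w_i (resp. v_i) are m + 1 simplicial vertices with pairwise disjoint
-- neighbourhoods, so each member of a cover contains at most two of them.
-- (3): if fewer than m members cover H⁽³⁾, for each i two of the twins v_{i,j} share a member, all of
-- whose vertices are within distance two of v_{i,j}; neither u¹₁ nor any v_{i',j'} with i' ≠ i is, so
-- these m − 1 members and the member of u¹₁ are distinct.
-- (4), (5): every edge leaving the rows Q₁ … Q_i starts at uⁿ_i, and no induced star or path contains
-- the 4-cycle uⁿ_i v_{i,1} u¹_{i+1} v_{i,2} (resp. the triangle uⁿ_i v_{i,1} v_{i,2}). So in a partition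
-- one of v_{i,1}, u¹_{i+1}, v_{i,2} lies in a member avoiding uⁿ_i, which therefore starts at row i + 1;
-- with the member of u¹₁ this gives m members with distinct lowest rows.

module Submission where

open import Defs
open import Data.Nat using (ℕ; zero; suc; _+_; _*_; _≤_; _<_; z≤n; s≤s; ⌈_/2⌉; _≤?_)
open import Data.Nat.Properties
  using (_<?_; suc-injective; m≢1+n+m; +-identityʳ; ≤-refl; ≤-trans; ≤-antisym; ≤-pred; <-trans; ≤-<-trans;
         <-≤-trans; <-irrefl; <-cmp; <⇒≤; ≰⇒>; ≮⇒≥; n<1+n; ⌈n/2⌉-mono; n≡⌈n+n/2⌉)
open import Data.Fin using (Fin; zero; suc; toℕ; fromℕ; fromℕ<; inject₁; combine)
open import Data.Fin.Properties
  using (toℕ-injective; toℕ<n; toℕ-inject₁; toℕ-fromℕ; toℕ-fromℕ<; inject₁-injective; combine-injective;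
         any?; injective⇒≤; pigeonhole)
open import Data.Product using (Σ; ∃; ∃₂; _×_; _,_; proj₁; proj₂)
open import Data.Sum using (_⊎_; inj₁; inj₂; swap; [_,_]′)
open import Data.Empty using (⊥; ⊥-elim)
open import Data.Unit using (tt)
open import Function using (_∘_)
open import Function.Definitions using (Injective)
open import Relation.Nullary using (¬_; Dec; yes; no)
open import Relation.Nullary.Decidable using (map′; ¬?; decidable-stable)
open import Relation.Unary using (Decidable)
open import Relation.Binary.PropositionalEquality
  using (_≡_; _≢_; refl; sym; trans; cong; cong₂; subst; subst₂)
open import Relation.Binary.Definitions using (tri<; tri≈; tri>)

-- Paths and stars

PathAdj : ℕ → ℕ → Set
PathAdj x y = suc x ≡ y ⊎ suc y ≡ x

no-path-edge-across-gap : ∀ x d → ¬ PathAdj x (suc (suc (d + x)))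
no-path-edge-across-gap x d (inj₁ e) = m≢1+n+m x (suc-injective e)
no-path-edge-across-gap x d (inj₂ e) = m≢1+n+m x (sym e)

path-triangle-free : ∀ {x y z} → PathAdj x y → PathAdj y z → PathAdj x z → ⊥
path-triangle-free (inj₁ refl) (inj₁ refl) (inj₁ ())
path-triangle-free (inj₁ refl) (inj₁ refl) (inj₂ ())
path-triangle-free (inj₁ refl) (inj₂ refl) (inj₁ ())
path-triangle-free (inj₁ refl) (inj₂ refl) (inj₂ ())
path-triangle-free (inj₂ refl) (inj₁ refl) (inj₁ ())
path-triangle-free (inj₂ refl) (inj₁ refl) (inj₂ ())
path-triangle-free (inj₂ refl) (inj₂ refl) (inj₁ ())
path-triangle-free (inj₂ refl) (inj₂ refl) (inj₂ ())

path-C₄-free : ∀ {x y z w} → x ≢ z → y ≢ w →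
               PathAdj x y → PathAdj y z → PathAdj z w → PathAdj w x → ⊥
path-C₄-free x≢z _ (inj₁ refl) (inj₂ refl) _ _ = x≢z refl
path-C₄-free x≢z _ (inj₂ refl) (inj₁ refl) _ _ = x≢z refl
path-C₄-free _ y≢w (inj₁ refl) (inj₁ refl) (inj₂ refl) _ = y≢w refl
path-C₄-free _ y≢w (inj₂ refl) (inj₂ refl) (inj₁ refl) _ = y≢w refl
path-C₄-free _ _ (inj₁ refl) (inj₁ refl) (inj₁ refl) (inj₁ ())
path-C₄-free _ _ (inj₁ refl) (inj₁ refl) (inj₁ refl) (inj₂ ())
path-C₄-free _ _ (inj₂ refl) (inj₂ refl) (inj₂ refl) (inj₁ ())
path-C₄-free _ _ (inj₂ refl) (inj₂ refl) (inj₂ refl) (inj₂ ())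

path-common-neighbour-gap : ∀ {α β γ} → α ≢ γ → PathAdj α β → PathAdj γ β →
                            γ ≡ suc (suc α) ⊎ α ≡ suc (suc γ)
path-common-neighbour-gap α≢γ (inj₁ refl) (inj₁ refl) = ⊥-elim (α≢γ refl)
path-common-neighbour-gap _   (inj₁ refl) (inj₂ refl) = inj₁ refl
path-common-neighbour-gap _   (inj₂ refl) (inj₁ refl) = inj₂ refl
path-common-neighbour-gap α≢γ (inj₂ refl) (inj₂ refl) = ⊥-elim (α≢γ refl)

PathNbrs⊆ : ℕ → ℕ → ℕ → Set
PathNbrs⊆ k α γ = ∀ β → β < k → PathAdj α β → PathAdj γ β

gap-two-not-twins : ∀ {k α} → 4 ≤ k → α < k →
                    PathNbrs⊆ k α (suc (suc α)) → PathNbrs⊆ k (suc (suc α)) α → ⊥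
gap-two-not-twins {α = zero}   4≤k _   _   γ⊆α = no-path-edge-across-gap 0 1 (γ⊆α 3 4≤k (inj₁ refl))
gap-two-not-twins {α = suc α'} _   α<k α⊆γ _   =
  no-path-edge-across-gap α' 1 (swap (α⊆γ α' (<-trans (n<1+n α') α<k) (inj₂ refl)))

path-has-neighbour : ∀ {k α} → 2 ≤ k → α < k → ∃ λ β → β < k × PathAdj α β
path-has-neighbour {α = zero}   2≤k _   = 1 , 2≤k , inj₁ refl
path-has-neighbour {α = suc α'} _   α<k = α' , <-trans (n<1+n α') α<k , inj₂ refl

path-twins⇒≤3 : ∀ {k α γ} → α < k → γ < k → α ≢ γ →
                      PathNbrs⊆ k α γ → PathNbrs⊆ k γ α → k ≤ 3
path-twins⇒≤3 {k} α<k γ<k α≢γ α⊆γ γ⊆α with 4 ≤? k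
... | no 4≰k = ≤-pred (≰⇒> 4≰k)
... | yes 4≤k with path-has-neighbour (≤-trans (s≤s (s≤s z≤n)) 4≤k) α<k
... | β , β<k , α~β with path-common-neighbour-gap α≢γ α~β (α⊆γ β β<k α~β)
... | inj₁ refl = ⊥-elim (gap-two-not-twins 4≤k α<k α⊆γ γ⊆α)
... | inj₂ refl = ⊥-elim (gap-two-not-twins 4≤k γ<k γ⊆α α⊆γ)

data Dist≤2 (G : Graph) (x : V G) : V G → Set where
  dist0 : Dist≤2 G x x
  dist1 : ∀ {y} → Adj G x y → Dist≤2 G x y
  dist2 : ∀ {y z} → Adj G x y → Adj G y z → Dist≤2 G x z

Dist≤2-emb : ∀ {G H a z} (c : InducedCopy G H) → Dist≤2 H a z → Dist≤2 G (emb c a) (emb c z)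
Dist≤2-emb c dist0         = dist0
Dist≤2-emb c (dist1 h)     = dist1 (emb-pres c _ _ h)
Dist≤2-emb c (dist2 h₁ h₂) = dist2 (emb-pres c _ _ h₁) (emb-pres c _ _ h₂)

short-path-radius : ∀ {k} → k ≤ 3 → (a z : Fin k) → Dist≤2 (Path k) a z
short-path-radius _ zero             zero             = dist0
short-path-radius _ zero             (suc zero)       = dist1 (inj₁ refl)
short-path-radius _ zero             (suc (suc zero)) = dist2 (inj₁ refl) (inj₁ refl)
short-path-radius _ (suc zero)       zero             = dist1 (inj₂ refl)
short-path-radius _ (suc zero)       (suc zero)       = dist0
short-path-radius _ (suc zero)       (suc (suc zero)) = dist1 (inj₁ refl)
short-path-radius _ (suc (suc zero)) zero             = dist2 (inj₂ refl) (inj₂ refl)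
short-path-radius _ (suc (suc zero)) (suc zero)       = dist1 (inj₂ refl)
short-path-radius _ (suc (suc zero)) (suc (suc zero)) = dist0
short-path-radius {suc (suc (suc (suc _)))} (s≤s (s≤s (s≤s ()))) _ _

module _ {k : ℕ} where
  private
    SA : Fin (suc k) → Fin (suc k) → Set
    SA = Adj (Star k)

  centre-leaf : ∀ {b} → SA zero (suc b)
  centre-leaf = inj₁ (refl , s≤s z≤n)

  leaf-centre : ∀ {a} → SA (suc a) zero
  leaf-centre = inj₂ (refl , s≤s z≤n)

  centres-not-adjacent : ¬ SA zero zero
  centres-not-adjacent (inj₁ (_ , ()))
  centres-not-adjacent (inj₂ (_ , ()))

  leaves-not-adjacent : ∀ {a b} → ¬ SA (suc a) (suc b)
  leaves-not-adjacent (inj₁ (() , _))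
  leaves-not-adjacent (inj₂ (() , _))

  star-triangle-free : ∀ {a b c} → SA a b → SA b c → SA a c → ⊥
  star-triangle-free {zero}  {zero}            ab _  _  = centres-not-adjacent ab
  star-triangle-free {zero}  {suc _} {zero}    _  _  ac = centres-not-adjacent ac
  star-triangle-free {zero}  {suc _} {suc _}   _  bc _  = leaves-not-adjacent bc
  star-triangle-free {suc _} {zero}  {zero}    _  bc _  = centres-not-adjacent bc
  star-triangle-free {suc _} {zero}  {suc _}   _  _  ac = leaves-not-adjacent ac
  star-triangle-free {suc _} {suc _}           ab _  _  = leaves-not-adjacent ab

  star-C₄-free : ∀ {a b c d} → a ≢ c → b ≢ d → SA a b → SA b c → SA c d → SA d a → ⊥
  star-C₄-free {zero}  {_}     {zero}          a≢c _   _  _  _  _ = a≢c refl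
  star-C₄-free {_}     {zero}  {_}     {zero}  _   b≢d _  _  _  _ = b≢d refl
  star-C₄-free {zero}  {zero}                  _   _   ab _  _  _ = centres-not-adjacent ab
  star-C₄-free {suc _} {suc _}                 _   _   ab _  _  _ = leaves-not-adjacent ab
  star-C₄-free {zero}  {suc _} {suc _}         _   _   _  bc _  _ = leaves-not-adjacent bc
  star-C₄-free {suc _} {zero}  {zero}          _   _   _  bc _  _ = centres-not-adjacent bc
  star-C₄-free {suc _} {zero}  {suc _} {suc _} _   _   _  _  cd _ = leaves-not-adjacent cd

  star-radius : (a z : Fin (suc k)) → Dist≤2 (Star k) a z
  star-radius zero    zero    = dist0
  star-radius zero    (suc _) = dist1 centre-leaf
  star-radius (suc _) zero    = dist1 leaf-centre
  star-radius (suc _) (suc _) = dist2 leaf-centre centre-leaf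

first-exit : ∀ {k} (Q : Fin (suc k) → Set) → Decidable Q → Q zero → ∀ {b} → ¬ Q b →
             ∃ λ i → Q (inject₁ i) × ¬ Q (suc i)
first-exit         Q Q? q₀ {zero}  ¬q = ⊥-elim (¬q q₀)
first-exit {suc k} Q Q? q₀ {suc b} ¬q with Q? (suc zero)
... | no ¬q₁ = zero , q₀ , ¬q₁
... | yes q₁ with first-exit (Q ∘ suc) (Q? ∘ suc) q₁ ¬q
...   | i , qi , ¬qi₊ = suc i , qi , ¬qi₊

n≤2*m⇒⌈n/2⌉≤m : ∀ {n m} → n ≤ 2 * m → ⌈ n /2⌉ ≤ m
n≤2*m⇒⌈n/2⌉≤m {n} {m} n≤2m =
  subst (⌈ n /2⌉ ≤_) (sym (n≡⌈n+n/2⌉ m)) (⌈n/2⌉-mono (subst (λ k → n ≤ m + k) (+-identityʳ m) n≤2m))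

-- Induced stars and paths in a graph

Simplicial : (G : Graph) → V G → Set
Simplicial G x = ∀ {y z} → Adj G x y → Adj G x z → y ≡ z ⊎ Adj G y z

module _ {G : Graph} where
  private
    A : V G → V G → Set
    A = Adj G

  image-any? : ∀ {n} (f : Fin n → V G) {P : V G → Set} → Decidable P →
               Dec (∃ λ x → (∃ λ a → f a ≡ x) × P x)
  image-any? f P? = map′ (λ (a , pa) → f a , (a , refl) , pa)
                         (λ { (_ , (a , refl) , px) → a , px })
                         (any? (P? ∘ f))

  SP-any? : (M : SP G) {P : V G → Set} → Decidable P → Dec (∃ λ x → x ∈SP M × P x)
  SP-any? (star _ _ c) = image-any? (emb c)
  SP-any? (path _ _ c) = image-any? (emb c)

  SP-boundary-edge : (M : SP G) {P : V G → Set} → Decidable P →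
                     ∀ {x y} → x ∈SP M → P x → y ∈SP M → ¬ P y →
                     ∃₂ λ a b → a ∈SP M × A a b × P a × ¬ P b
  SP-boundary-edge (star _ _ c) P? (α , refl) px (β , refl) ¬py with P? (emb c zero) | α | β
  ... | yes p₀ | _ | zero   = ⊥-elim (¬py p₀)
  ... | yes p₀ | _ | suc β' = _ , _ , (zero , refl) , emb-pres c zero (suc β') centre-leaf , p₀ , ¬py
  ... | no ¬p₀ | zero   | _ = ⊥-elim (¬p₀ px)
  ... | no ¬p₀ | suc α' | _ = _ , _ , (suc α' , refl) , emb-pres c (suc α') zero leaf-centre , px , ¬p₀
  SP-boundary-edge (path (suc k) _ c) {P} P? (α , refl) px (β , refl) ¬py with P? (emb c zero)
  ... | yes p₀ with first-exit (P ∘ emb c) (P? ∘ emb c) p₀ ¬py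
  ...   | i , pi , ¬pi₊ =
    _ , _ , (inject₁ i , refl) , emb-pres c (inject₁ i) (suc i) (inj₁ (cong suc (toℕ-inject₁ i))) , pi , ¬pi₊
  SP-boundary-edge (path (suc k) _ c) {P} P? (α , refl) px (β , refl) ¬py | no ¬p₀
    with first-exit (¬_ ∘ P ∘ emb c) (¬? ∘ P? ∘ emb c) ¬p₀ (λ ¬px → ¬px px)
  ...   | i , ¬pi , ¬¬pi₊ =
    _ , _ , (suc i , refl) , emb-pres c (suc i) (inject₁ i) (inj₂ (cong suc (toℕ-inject₁ i))) ,
    decidable-stable (P? _) ¬¬pi₊ , ¬pi

  SP-triangle-free : (M : SP G) {x y z : V G} → x ∈SP M → y ∈SP M → z ∈SP M →
                     A x y → A y z → A x z → ⊥
  SP-triangle-free (star _ _ c) (a , refl) (b , refl) (d , refl) xy yz xz =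
    star-triangle-free (emb-refl c a b xy) (emb-refl c b d yz) (emb-refl c a d xz)
  SP-triangle-free (path _ _ c) (a , refl) (b , refl) (d , refl) xy yz xz =
    path-triangle-free (emb-refl c a b xy) (emb-refl c b d yz) (emb-refl c a d xz)

  SP-C₄-free : (M : SP G) {w x y z : V G} → w ∈SP M → x ∈SP M → y ∈SP M → z ∈SP M →
               w ≢ y → x ≢ z → A w x → A x y → A y z → A z w → ⊥
  SP-C₄-free (star _ _ c) (a , refl) (b , refl) (d , refl) (e , refl) w≢y x≢z wx xy yz zw =
    star-C₄-free (w≢y ∘ cong (emb c)) (x≢z ∘ cong (emb c))
      (emb-refl c a b wx) (emb-refl c b d xy) (emb-refl c d e yz) (emb-refl c e a zw)
  SP-C₄-free (path _ _ c) (a , refl) (b , refl) (d , refl) (e , refl) w≢y x≢z wx xy yz zw =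
    path-C₄-free (w≢y ∘ cong (emb c) ∘ toℕ-injective) (x≢z ∘ cong (emb c) ∘ toℕ-injective)
      (emb-refl c a b wx) (emb-refl c b d xy) (emb-refl c d e yz) (emb-refl c e a zw)

  path-nbrs⊆ : ∀ {k} (c : InducedCopy G (Path k)) {a a' : Fin k} →
               (∀ {y} → A (emb c a) y → A (emb c a') y) → PathNbrs⊆ k (toℕ a) (toℕ a')
  path-nbrs⊆ {k} c {a} {a'} a⊆a' β β<k a~β =
    subst (PathAdj (toℕ a')) (toℕ-fromℕ< β<k)
      (emb-refl c a' b (a⊆a' (emb-pres c a b (subst (PathAdj (toℕ a)) (sym (toℕ-fromℕ< β<k)) a~β))))
    where
    b : Fin k
    b = fromℕ< β<k

  SP-twin-radius : (M : SP G) {x x' z : V G} → x ∈SP M → x' ∈SP M → z ∈SP M → x ≢ x' →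
                   (∀ {y} → A x y → A x' y) → (∀ {y} → A x' y → A x y) → Dist≤2 G x z
  SP-twin-radius (star _ _ c) (a , refl) _ (d , refl) _ _ _ = Dist≤2-emb c (star-radius a d)
  SP-twin-radius (path k _ c) (a , refl) (a' , refl) (d , refl) x≢x' x⊆x' x'⊆x =
    Dist≤2-emb c (short-path-radius short a d)
    where
    short : k ≤ 3
    short = path-twins⇒≤3 (toℕ<n a) (toℕ<n a') (x≢x' ∘ cong (emb c) ∘ toℕ-injective)
              (path-nbrs⊆ c x⊆x') (path-nbrs⊆ c x'⊆x)

  path-interior-not-simplicial : ∀ {k} (c : InducedCopy G (Path (suc k))) (a : Fin k) →
                                 suc (toℕ a) < k → ¬ Simplicial G (emb c (suc a))
  path-interior-not-simplicial {k} c a h simplicial =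
    [ apart ∘ emb-inj c , not-adjacent ∘ emb-refl c prev next ]′
      (simplicial (emb-pres c (suc a) prev (inj₂ (cong suc prev≡)))
                  (emb-pres c (suc a) next (inj₁ (sym next≡))))
    where
    prev next : Fin (suc k)
    prev = inject₁ a
    next = suc (fromℕ< h)
    prev≡ : toℕ prev ≡ toℕ a
    prev≡ = toℕ-inject₁ a
    next≡ : toℕ next ≡ suc (suc (toℕ a))
    next≡ = cong suc (toℕ-fromℕ< h)
    apart : prev ≢ next
    apart e = m≢1+n+m (toℕ a) (trans (sym prev≡) (trans (cong toℕ e) next≡))
    not-adjacent : ¬ PathAdj (toℕ prev) (toℕ next)
    not-adjacent = no-path-edge-across-gap (toℕ a) 0 ∘ subst₂ PathAdj prev≡ next≡

  rootFlag : (M : SP G) {x : V G} → x ∈SP M → Fin 2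
  rootFlag (star _ _ _) (zero  , _) = zero
  rootFlag (star _ _ _) (suc _ , _) = suc zero
  rootFlag (path _ _ _) (zero  , _) = zero
  rootFlag (path _ _ _) (suc _ , _) = suc zero

  same-flag-simplicial-share-neighbour :
    (M : SP G) {x y : V G} (p : x ∈SP M) (q : y ∈SP M) → rootFlag M p ≡ rootFlag M q →
    Simplicial G x → Simplicial G y → x ≡ y ⊎ ∃ λ c → A x c × A y c
  same-flag-simplicial-share-neighbour (star _ _ c) (zero  , refl) (zero  , refl) _ _ _ = inj₁ refl
  same-flag-simplicial-share-neighbour (star _ _ c) (suc a , refl) (suc b , refl) _ _ _ =
    inj₂ (emb c zero , emb-pres c (suc a) zero leaf-centre , emb-pres c (suc b) zero leaf-centre)
  same-flag-simplicial-share-neighbour (path _ _ c) (zero  , refl) (zero  , refl) _ _ _ = inj₁ refl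
  same-flag-simplicial-share-neighbour (path _ _ c) (suc a , refl) (suc b , refl) _ sx sy
    with <-cmp (toℕ a) (toℕ b)
  ... | tri< a<b _ _ = ⊥-elim (path-interior-not-simplicial c a (≤-<-trans a<b (toℕ<n b)) sx)
  ... | tri≈ _ a≡b _ = inj₁ (cong (emb c ∘ suc) (toℕ-injective a≡b))
  ... | tri> _ _ b<a = ⊥-elim (path-interior-not-simplicial c b (≤-<-trans b<a (toℕ<n a)) sy)

  -- Counting arguments

  simplicial-count : ∀ {L} (s : Fin L → V G) → (∀ l → ∃ (A (s l))) → (∀ l → Simplicial G (s l)) →
                     (∀ {l l' y} → A (s l) y → A (s l') y → l ≡ l') → InspcAtLeast G ⌈ L /2⌉
  simplicial-count {L} s s-nonisolated s-simplicial apart t C = n≤2*m⇒⌈n/2⌉≤m (injective⇒≤ slot-injective)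
    where
    open SPCover C
    Home : Fin L → Set
    Home l = ∃ λ j → s l ∈SP member j
    slotOf : ∀ {l} → Home l → Fin (2 * t)
    slotOf (j , p) = combine (rootFlag (member j) p) j
    slot : Fin L → Fin (2 * t)
    slot l = slotOf (covers (s l))
    same-slot : ∀ {l l'} (h : Home l) (h' : Home l') → slotOf h ≡ slotOf h' → l ≡ l'
    same-slot {l} (j , p) (j' , p') eq
      with combine-injective (rootFlag (member j) p) j (rootFlag (member j') p') j' eq
    ... | flag≡ , refl
      with same-flag-simplicial-share-neighbour (member j) p p' flag≡ (s-simplicial _) (s-simplicial _)
    ...   | inj₁ e            = let (y , sy) = s-nonisolated l in apart sy (subst (λ x → A x y) e sy)
    ...   | inj₂ (_ , y , y') = apart y y'
    slot-injective : Injective _≡_ _≡_ slot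
    slot-injective = same-slot (covers _) (covers _)

  twin-count : ∀ {r s} (twin : Fin r → Fin s → V G) → (∀ i → Injective _≡_ _≡_ (twin i)) →
               (∀ i k k' {y} → A (twin i k) y → A (twin i k') y) →
               (base : V G) → (∀ i k → ¬ Dist≤2 G (twin i k) base) →
               (∀ i k i' k' → Dist≤2 G (twin i k) (twin i' k') → i ≡ i') →
               ∀ t → SPCover G t → t < s → suc r ≤ t
  twin-count {r} twin twin-inj twin-nbrs base base-far classes-far t C t<s = injective⇒≤ g-injective
    where
    open SPCover C
    Hub : Fin r → Fin t → Set
    Hub i j = ∃ λ k → twin i k ∈SP member j × (∀ {z} → z ∈SP member j → Dist≤2 G (twin i k) z)
    twins-hub : ∀ i {k k'} → k ≢ k' → proj₁ (covers (twin i k)) ≡ proj₁ (covers (twin i k')) →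
                Hub i (proj₁ (covers (twin i k)))
    twins-hub i {k} {k'} k≢k' same = k , p , λ z∈ →
      SP-twin-radius (member _) p p' z∈ (k≢k' ∘ twin-inj i) (twin-nbrs i k k') (twin-nbrs i k' k)
      where
      p : twin i k ∈SP member (proj₁ (covers (twin i k)))
      p = proj₂ (covers (twin i k))
      p' : twin i k' ∈SP member (proj₁ (covers (twin i k)))
      p' = subst (λ j → twin i k' ∈SP member j) (sym same) (proj₂ (covers (twin i k')))
    hub : ∀ i → Σ (Fin t) (Hub i)
    hub i with pigeonhole t<s (λ k → proj₁ (covers (twin i k)))
    ... | k , k' , k<k' , same = _ , twins-hub i (λ k≡k' → <-irrefl (cong toℕ k≡k') k<k') same
    g : Fin (suc r) → Fin t
    g zero    = proj₁ (covers base)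
    g (suc i) = proj₁ (hub i)
    near-hub : ∀ i {z} → z ∈SP member (g (suc i)) → ∃ λ k → Dist≤2 G (twin i k) z
    near-hub i = let (_ , k , _ , radius) = hub i in λ z∈ → k , radius z∈
    base-in : ∀ {j} → g zero ≡ j → base ∈SP member j
    base-in refl = proj₂ (covers base)
    g-injective : Injective _≡_ _≡_ g
    g-injective {zero}  {zero}   _  = refl
    g-injective {zero}  {suc i}  eq = let (k , d) = near-hub i (base-in eq) in ⊥-elim (base-far i k d)
    g-injective {suc i} {zero}   eq = let (k , d) = near-hub i (base-in (sym eq)) in ⊥-elim (base-far i k d)
    g-injective {suc i} {suc i'} eq =
      let (_ , k' , p' , _) = hub i'
          (k , d) = near-hub i (subst (λ j → twin i' k' ∈SP member j) (sym eq) p')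
      in cong suc (classes-far i k i' k' d)

record Layering (G : Graph) (r s : ℕ) : Set₁ where
  field
    Below              : ℕ → V G → Set
    Below?             : ∀ h → Decidable (Below h)
    Below-mono         : ∀ {h h' x} → h ≤ h' → Below h x → Below h' x
    base               : V G
    base-below         : Below 0 base
    gate               : Fin r → V G
    gate-cut           : ∀ i {a b} → Adj G a b → Below (toℕ i) a → ¬ Below (toℕ i) b → a ≡ gate i
    witness            : Fin r → Fin s → V G
    witness-between    : ∀ i k → Below (suc (toℕ i)) (witness i k) × ¬ Below (toℕ i) (witness i k)
    no-SP-contains-all : ∀ i (M : SP G) → gate i ∈SP M → (∀ k → witness i k ∈SP M) → ⊥

layering-count : ∀ {G r s} → Layering G r s → InsppAtLeast G (suc r)
layering-count {r = r} {s = s} L t P = injective⇒≤ g-injective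
  where
  open Layering L
  open SPPartition P
  Meets : ℕ → Fin t → Set
  Meets h j = ∃ λ z → z ∈SP member j × Below h z
  Starts : ℕ → Fin t → Set
  Starts h j = Meets h j × (∀ {z h'} → z ∈SP member j → h' < h → ¬ Below h' z)
  starts-unique : ∀ {h h' j} → Starts h j → Starts h' j → h ≡ h'
  starts-unique {h} {h'} ((z , z∈ , bz) , avoid) ((z' , z'∈ , bz') , avoid') with <-cmp h h'
  ... | tri< h<h' _ _ = ⊥-elim (avoid' z∈ h<h' bz)
  ... | tri≈ _ h≡h' _ = h≡h'
  ... | tri> _ _ h'<h = ⊥-elim (avoid z'∈ h'<h bz')
  gate-joins : ∀ i {j x} → x ∈SP member j → ¬ Below (toℕ i) x → Meets (toℕ i) j → gate i ∈SP member j
  gate-joins i {j} x∈ ¬bx (z , z∈ , bz) with SP-boundary-edge (member j) (Below? (toℕ i)) z∈ bz x∈ ¬bx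
  ... | a , b , a∈ , ab , ba , ¬bb = subst (_∈SP member j) (gate-cut i ab ba ¬bb) a∈
  home : Fin r → Fin s → Fin t
  home i k = proj₁ (covers (witness i k))
  home∈ : ∀ i k → witness i k ∈SP member (home i k)
  home∈ i k = proj₂ (covers (witness i k))
  all-meet-impossible : ∀ i → (∀ k → Meets (toℕ i) (home i k)) → ⊥
  all-meet-impossible i meets = no-SP-contains-all i (member j₀) gate∈ witness∈
    where
    j₀ : Fin t
    j₀ = proj₁ (covers (gate i))
    gate∈ : gate i ∈SP member j₀
    gate∈ = proj₂ (covers (gate i))
    witness∈ : ∀ k → witness i k ∈SP member j₀
    witness∈ k = subst (λ j → witness i k ∈SP member j)
      (disjoint _ j₀ (gate i) (gate-joins i (home∈ i k) (proj₂ (witness-between i k)) (meets k)) gate∈)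
      (home∈ i k)
  entering : ∀ i → Σ (Fin t) (Starts (suc (toℕ i)))
  entering i with any? (λ k → ¬? (SP-any? (member (home i k)) (Below? (toℕ i))))
  ... | yes (k , avoids) = home i k , (witness i k , home∈ i k , proj₁ (witness-between i k)) ,
                           λ z∈ h'<h bz → avoids (_ , z∈ , Below-mono (≤-pred h'<h) bz)
  ... | no ¬avoids = ⊥-elim (all-meet-impossible i λ k →
                       decidable-stable (SP-any? (member (home i k)) (Below? (toℕ i))) (¬avoids ∘ (k ,_)))
  g : Fin (suc r) → Fin t
  g zero    = proj₁ (covers base)
  g (suc i) = proj₁ (entering i)
  starts : ∀ x → Starts (toℕ x) (g x)
  starts zero    = (base , proj₂ (covers base) , base-below) , λ _ ()
  starts (suc i) = proj₂ (entering i)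
  g-injective : Injective _≡_ _≡_ g
  g-injective {x} {y} eq = toℕ-injective (starts-unique (subst (Starts (toℕ x)) eq (starts x)) (starts y))

-- The graphs H⁽¹⁾ … H⁽⁵⁾

toℕ≢n : ∀ {n} (i : Fin n) → toℕ i ≢ n
toℕ≢n i e = <-irrefl e (toℕ<n i)

module Grid (m₂ n₂ : ℕ) where
  m n : ℕ
  m = suc (suc m₂)
  n = suc (suc (suc n₂))

  lastRow : Fin m
  lastRow = fromℕ (suc m₂)

  lastCol penultCol : Fin n
  lastCol   = fromℕ (suc (suc n₂))
  penultCol = inject₁ (fromℕ (suc n₂))

  toℕ-lastRow : toℕ lastRow ≡ suc m₂
  toℕ-lastRow = toℕ-fromℕ (suc m₂)

  toℕ-lastCol : toℕ lastCol ≡ suc (suc n₂)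
  toℕ-lastCol = toℕ-fromℕ (suc (suc n₂))

  penultCol-before-lastCol : suc (toℕ penultCol) ≡ toℕ lastCol
  penultCol-before-lastCol = cong suc (toℕ-inject₁ (fromℕ (suc n₂)))

  penultCol≢lastCol : penultCol ≢ lastCol
  penultCol≢lastCol e = m≢1+n+m (toℕ penultCol) {0} (trans (cong toℕ e) (sym penultCol-before-lastCol))

  at-lastCol : ∀ {j : Fin n} → suc (toℕ j) ≡ n → j ≡ lastCol
  at-lastCol e = toℕ-injective (trans (suc-injective e) (sym toℕ-lastCol))

  before-lastCol : ∀ {j : Fin n} → suc (toℕ j) ≡ toℕ lastCol → j ≡ penultCol
  before-lastCol e = toℕ-injective (suc-injective (trans e (sym penultCol-before-lastCol)))

  past-lastCol : ∀ {j : Fin n} → suc (toℕ lastCol) ≢ toℕ j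
  past-lastCol {j} e = toℕ≢n j (trans (sym e) (cong suc toℕ-lastCol))

  past-lastRow : ∀ {i : Fin m} → toℕ i ≢ suc (toℕ lastRow)
  past-lastRow {i} e = toℕ≢n i (trans e (cong suc toℕ-lastRow))

  no-gap-after-lastRow : ∀ {i : Fin (suc m₂)} → toℕ lastRow ≢ toℕ i
  no-gap-after-lastRow {i} e = toℕ≢n i (trans (sym e) toℕ-lastRow)

module H1-bound (m₂ n₂ : ℕ) where
  open Grid m₂ n₂

  pendant anchor : Fin (suc m) → V1 m n
  pendant zero          = u zero zero
  pendant (suc zero)    = u lastRow lastCol
  pendant (suc (suc i)) = w i
  anchor zero           = u zero (suc zero)
  anchor (suc zero)     = u lastRow penultCol
  anchor (suc (suc i))  = v i

  anchor-adjacent : ∀ l → Adj (H1 m n) (pendant l) (anchor l)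
  anchor-adjacent zero          = inj₁ (path zero zero (suc zero) refl)
  anchor-adjacent (suc zero)    = inj₂ (path lastRow penultCol lastCol penultCol-before-lastCol)
  anchor-adjacent (suc (suc i)) = inj₂ (vw i)

  anchor-unique : ∀ l {y} → Adj (H1 m n) (pendant l) y → y ≡ anchor l
  anchor-unique zero          (inj₁ (path _ _ _ e))      = cong (u zero) (toℕ-injective (sym e))
  anchor-unique zero          (inj₂ (path _ _ _ ()))
  anchor-unique zero          (inj₂ (vlast _ _ _ _ ()))
  anchor-unique zero          (inj₂ (vfirst _ _ _ () _))
  anchor-unique (suc zero)    (inj₁ (path _ _ _ e))      = ⊥-elim (past-lastCol e)
  anchor-unique (suc zero)    (inj₂ (path _ _ _ e))      = cong (u lastRow) (before-lastCol e)
  anchor-unique (suc zero)    (inj₂ (vlast _ _ _ e _))   = ⊥-elim (no-gap-after-lastRow e)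
  anchor-unique (suc zero)    (inj₂ (vfirst _ _ _ _ ()))
  anchor-unique (suc (suc i)) (inj₂ (vw _))              = refl

  anchor-injective : Injective _≡_ _≡_ anchor
  anchor-injective {zero}        {zero}         _    = refl
  anchor-injective {suc zero}    {suc zero}     _    = refl
  anchor-injective {suc (suc i)} {suc (suc .i)} refl = refl
  anchor-injective {zero}        {suc zero}     ()
  anchor-injective {zero}        {suc (suc _)}  ()
  anchor-injective {suc zero}    {zero}         ()
  anchor-injective {suc zero}    {suc (suc _)}  ()
  anchor-injective {suc (suc _)} {zero}         ()
  anchor-injective {suc (suc _)} {suc zero}     ()

  bound : InspcAtLeast (H1 m n) ⌈ suc m /2⌉
  bound = simplicial-count pendant (λ l → anchor l , anchor-adjacent l)
            (λ l y z → inj₁ (trans (anchor-unique l y) (sym (anchor-unique l z))))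
            (λ y y' → anchor-injective (trans (sym (anchor-unique _ y)) (anchor-unique _ y')))

module H2-bound (m₂ n₂ : ℕ) where
  open Grid m₂ n₂

  pendant : Fin (suc m) → V2 m n
  pendant zero          = u zero zero
  pendant (suc zero)    = u lastRow lastCol
  pendant (suc (suc i)) = v i

  anchor : Fin (suc m) → Fin 2 → V2 m n
  anchor zero          _          = u zero (suc zero)
  anchor (suc zero)    _          = u lastRow penultCol
  anchor (suc (suc i)) zero       = u (inject₁ i) lastCol
  anchor (suc (suc i)) (suc zero) = u (suc i) zero

  gap-ends-adjacent : ∀ i → E2 m n (u (inject₁ i) lastCol) (u (suc i) zero)
  gap-ends-adjacent i =
    uu (inject₁ i) (suc i) lastCol zero (cong suc (sym (toℕ-inject₁ i))) (cong suc toℕ-lastCol) refl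

  anchor-adjacent : ∀ l → Adj (H2 m n) (pendant l) (anchor l zero)
  anchor-adjacent zero          = inj₁ (path zero zero (suc zero) refl)
  anchor-adjacent (suc zero)    = inj₂ (path lastRow penultCol lastCol penultCol-before-lastCol)
  anchor-adjacent (suc (suc i)) = inj₁ (vlast i (inject₁ i) lastCol (toℕ-inject₁ i) (cong suc toℕ-lastCol))

  anchors-complete : ∀ l {y} → Adj (H2 m n) (pendant l) y → ∃ λ a → y ≡ anchor l a
  anchors-complete zero          (inj₁ (path _ _ _ e))        = zero , cong (u zero) (toℕ-injective (sym e))
  anchors-complete zero          (inj₁ (uu _ _ _ _ _ () _))
  anchors-complete zero          (inj₂ (path _ _ _ ()))
  anchors-complete zero          (inj₂ (vlast _ _ _ _ ()))
  anchors-complete zero          (inj₂ (vfirst _ _ _ () _))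
  anchors-complete zero          (inj₂ (uu _ _ _ _ () _ _))
  anchors-complete (suc zero)    (inj₁ (path _ _ _ e))        = ⊥-elim (past-lastCol e)
  anchors-complete (suc zero)    (inj₁ (uu _ _ _ _ e _ _))    = ⊥-elim (past-lastRow e)
  anchors-complete (suc zero)    (inj₂ (path _ _ _ e))        = zero , cong (u lastRow) (before-lastCol e)
  anchors-complete (suc zero)    (inj₂ (vlast _ _ _ e _))     = ⊥-elim (no-gap-after-lastRow e)
  anchors-complete (suc zero)    (inj₂ (vfirst _ _ _ _ ()))
  anchors-complete (suc zero)    (inj₂ (uu _ _ _ _ _ _ ()))
  anchors-complete (suc (suc i)) (inj₁ (vlast _ _ _ e₁ e₂))   =
    zero , cong₂ u (toℕ-injective (trans e₁ (sym (toℕ-inject₁ i)))) (at-lastCol e₂)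
  anchors-complete (suc (suc i)) (inj₁ (vfirst _ _ _ e₁ e₂))  =
    suc zero , cong₂ u (toℕ-injective e₁) (toℕ-injective e₂)

  anchors-clique : ∀ l a b → anchor l a ≡ anchor l b ⊎ Adj (H2 m n) (anchor l a) (anchor l b)
  anchors-clique zero          _          _          = inj₁ refl
  anchors-clique (suc zero)    _          _          = inj₁ refl
  anchors-clique (suc (suc i)) zero       zero       = inj₁ refl
  anchors-clique (suc (suc i)) zero       (suc zero) = inj₂ (inj₁ (gap-ends-adjacent i))
  anchors-clique (suc (suc i)) (suc zero) zero       = inj₂ (inj₂ (gap-ends-adjacent i))
  anchors-clique (suc (suc i)) (suc zero) (suc zero) = inj₁ refl

  u-injective : ∀ {i i' : Fin m} {j j' : Fin n} → _≡_ {A = V2 m n} (u i j) (u i' j') → i ≡ i' × j ≡ j'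
  u-injective refl = refl , refl

  anchor-injective : ∀ {l l' a b} → anchor l a ≡ anchor l' b → l ≡ l'
  anchor-injective {zero}        {zero}                        _  = refl
  anchor-injective {suc zero}    {suc zero}                    _  = refl
  anchor-injective {zero}        {suc zero}                    ()
  anchor-injective {suc zero}    {zero}                        ()
  anchor-injective {zero}        {suc (suc _)} {_}    {zero}     ()
  anchor-injective {zero}        {suc (suc _)} {_}    {suc zero} ()
  anchor-injective {suc (suc _)} {zero}        {zero}            ()
  anchor-injective {suc (suc _)} {zero}        {suc zero}        ()
  anchor-injective {suc zero}    {suc (suc _)} {_}    {zero}     e  =
    ⊥-elim (penultCol≢lastCol (proj₂ (u-injective e)))
  anchor-injective {suc zero}    {suc (suc _)} {_}    {suc zero} ()
  anchor-injective {suc (suc _)} {suc zero}    {zero}            e  =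
    ⊥-elim (penultCol≢lastCol (sym (proj₂ (u-injective e))))
  anchor-injective {suc (suc _)} {suc zero}    {suc zero}        ()
  anchor-injective {suc (suc i)} {suc (suc i')} {zero}   {zero}     e    =
    cong (λ k → suc (suc k)) (inject₁-injective (proj₁ (u-injective e)))
  anchor-injective {suc (suc _)} {suc (suc _)}  {zero}   {suc zero} ()
  anchor-injective {suc (suc _)} {suc (suc _)}  {suc zero} {zero}   ()
  anchor-injective {suc (suc i)} {suc (suc .i)} {suc zero} {suc zero} refl = refl

  pendant-simplicial : ∀ l → Simplicial (H2 m n) (pendant l)
  pendant-simplicial l y z with anchors-complete l y | anchors-complete l z
  ... | a , refl | b , refl = anchors-clique l a b

  bound : InspcAtLeast (H2 m n) ⌈ suc m /2⌉
  bound = simplicial-count pendant (λ l → anchor l zero , anchor-adjacent l) pendant-simplicial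
            (λ y y' → anchor-injective (trans (sym (proj₂ (anchors-complete _ y))) (proj₂ (anchors-complete _ y'))))

module H3-bound (m₂ n₂ : ℕ) where
  open Grid m₂ n₂

  gap-twins : ∀ i k k' {y} → Adj (H3 m n) (v i k) y → Adj (H3 m n) (v i k') y
  gap-twins i k k' (inj₁ (vlast _ _ i' j e₁ e₂))  = inj₁ (vlast i k' i' j e₁ e₂)
  gap-twins i k k' (inj₁ (vfirst _ _ i' j e₁ e₂)) = inj₁ (vfirst i k' i' j e₁ e₂)

  gap-far-from-origin : ∀ i k → ¬ Dist≤2 (H3 m n) (v i k) (u zero zero)
  gap-far-from-origin i k (dist1 (inj₁ (vlast _ _ _ _ _ ())))
  gap-far-from-origin i k (dist1 (inj₁ (vfirst _ _ _ _ () _)))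
  gap-far-from-origin i k (dist2 (inj₁ (vlast _ _ _ _ _ _)) (inj₁ (path _ _ _ ())))
  -- n ≥ 3 is used here: u²₁ must not be uⁿ₁
  gap-far-from-origin i k (dist2 (inj₁ (vlast _ _ _ _ _ e)) (inj₂ (path _ _ _ e')))
    with trans (cong suc e') e
  ... | ()
  gap-far-from-origin i k (dist2 (inj₁ (vfirst _ _ _ _ () _)) (inj₁ (path _ _ _ _)))
  gap-far-from-origin i k (dist2 (inj₁ (vfirst _ _ _ _ () _)) (inj₂ (path _ _ _ _)))

  gap-index-of-nearby : ∀ {i k i' k'} → Dist≤2 (H3 m n) (v i k) (v i' k') → i ≡ i'
  gap-index-of-nearby dist0 = refl
  gap-index-of-nearby (dist1 (inj₁ ()))
  gap-index-of-nearby (dist1 (inj₂ ()))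
  gap-index-of-nearby (dist2 (inj₁ (vlast _ _ _ _ e₁ _)) (inj₂ (vlast _ _ _ _ e₁' _))) =
    toℕ-injective (trans (sym e₁) e₁')
  gap-index-of-nearby (dist2 (inj₁ (vlast _ _ _ _ _ e₂)) (inj₂ (vfirst _ _ _ _ _ e₂')))
    with trans (cong suc (sym e₂')) e₂
  ... | ()
  gap-index-of-nearby (dist2 (inj₁ (vfirst _ _ _ _ _ e₂)) (inj₂ (vlast _ _ _ _ _ e₂')))
    with trans (cong suc (sym e₂)) e₂'
  ... | ()
  gap-index-of-nearby (dist2 (inj₁ (vfirst _ _ _ _ e₁ _)) (inj₂ (vfirst _ _ _ _ e₁' _))) =
    toℕ-injective (suc-injective (trans (sym e₁) e₁'))

  bound : InspcAtLeast (H3 m n) m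
  bound t C with m ≤? t
  ... | yes m≤t = m≤t
  ... | no  m≰t = twin-count v (λ _ → λ { refl → refl }) gap-twins (u zero zero) gap-far-from-origin
                    (λ _ _ _ _ → gap-index-of-nearby) t C (≰⇒> m≰t)

module H45-layers (m₂ n₂ : ℕ) where
  open Grid m₂ n₂

  W : Set
  W = Σ (V3 m n) Keep4

  -- a gap vertex v_i lies between the rows i and i + 1
  Below : ℕ → W → Set
  Below h (u i _ , _) = toℕ i ≤ h
  Below h (v i _ , _) = toℕ i < h

  Below? : ∀ h → Decidable (Below h)
  Below? h (u i _ , _) = toℕ i ≤? h
  Below? h (v i _ , _) = toℕ i <? h

  Below-mono : ∀ {h h' x} → h ≤ h' → Below h x → Below h' x
  Below-mono {x = u _ _ , _} h≤h' b = ≤-trans b h≤h'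
  Below-mono {x = v _ _ , _} h≤h' b = <-≤-trans b h≤h'

  gate : Fin (suc m₂) → W
  gate i = u (inject₁ i) lastCol , tt

  witness : Fin (suc m₂) → Fin 3 → W
  witness i zero             = v i zero , s≤s z≤n
  witness i (suc zero)       = u (suc i) zero , tt
  witness i (suc (suc zero)) = v i (suc zero) , s≤s (s≤s z≤n)

  gate-cut : ∀ i {a b : W} → Sym (E3 m n) (proj₁ a) (proj₁ b) → Below (toℕ i) a → ¬ Below (toℕ i) b →
             a ≡ gate i
  gate-cut i {u _ _ , _} {u _ _ , _} (inj₁ (path _ _ _ _))       ba ¬bb = ⊥-elim (¬bb ba)
  gate-cut i {u _ _ , _} {u _ _ , _} (inj₂ (path _ _ _ _))       ba ¬bb = ⊥-elim (¬bb ba)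
  gate-cut i {v _ _ , _} {u _ _ , _} (inj₁ (vlast _ _ _ _ e₁ _))  ba ¬bb =
    ⊥-elim (¬bb (subst (_≤ toℕ i) (sym e₁) (<⇒≤ ba)))
  gate-cut i {v _ _ , _} {u _ _ , _} (inj₁ (vfirst _ _ _ _ e₁ _)) ba ¬bb =
    ⊥-elim (¬bb (subst (_≤ toℕ i) (sym e₁) ba))
  gate-cut i {u _ _ , _} {v _ _ , _} (inj₂ (vfirst _ _ _ _ e₁ _)) ba ¬bb =
    ⊥-elim (¬bb (subst (_≤ toℕ i) e₁ ba))
  gate-cut i {u r _ , _} {v g _ , _} (inj₂ (vlast _ _ _ _ e₁ e₂)) ba ¬bb =
    cong₂ (λ r' c → u r' c , tt) (toℕ-injective row≡) (at-lastCol e₂)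
    where
    gap≡i : toℕ g ≡ toℕ i
    gap≡i = ≤-antisym (subst (_≤ toℕ i) e₁ ba) (≮⇒≥ ¬bb)
    row≡ : toℕ r ≡ toℕ (inject₁ i)
    row≡ = trans e₁ (trans gap≡i (sym (toℕ-inject₁ i)))

  witness-between : ∀ i k → Below (suc (toℕ i)) (witness i k) × ¬ Below (toℕ i) (witness i k)
  witness-between i zero             = ≤-refl , <-irrefl refl
  witness-between i (suc zero)       = ≤-refl , <-irrefl refl
  witness-between i (suc (suc zero)) = ≤-refl , <-irrefl refl

  gate-to-gap : ∀ i k → Sym (E3 m n) (u (inject₁ i) lastCol) (v i k)
  gate-to-gap i k = inj₂ (vlast i k (inject₁ i) lastCol (toℕ-inject₁ i) (cong suc toℕ-lastCol))

  gap-to-next : ∀ i k → Sym (E3 m n) (v i k) (u (suc i) zero)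
  gap-to-next i k = inj₁ (vfirst i k (suc i) zero refl refl)

  H4-layering : Layering (H4 m n) (suc m₂) 3
  H4-layering = record
    { Below = Below ; Below? = Below? ; Below-mono = Below-mono
    ; base = u zero zero , tt ; base-below = z≤n
    ; gate = gate ; gate-cut = gate-cut
    ; witness = witness ; witness-between = witness-between
    ; no-SP-contains-all = λ i M gate∈ w∈ →
        SP-C₄-free M gate∈ (w∈ zero) (w∈ (suc zero)) (w∈ (suc (suc zero))) (λ ()) (λ ())
          (gate-to-gap i zero) (gap-to-next i zero)
          (swap (gap-to-next i (suc zero))) (swap (gate-to-gap i (suc zero)))
    }

  gate-cut₅ : ∀ i {a b} → Adj (H5 m n) a b → Below (toℕ i) a → ¬ Below (toℕ i) b → a ≡ gate i
  gate-cut₅ i                         (inj₁ e)                     = gate-cut i e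
  gate-cut₅ i {v _ _ , _} {v _ _ , _} (inj₂ (inj₁ (vv _ _ _ _ _))) ba ¬bb = ⊥-elim (¬bb ba)
  gate-cut₅ i {v _ _ , _} {v _ _ , _} (inj₂ (inj₂ (vv _ _ _ _ _))) ba ¬bb = ⊥-elim (¬bb ba)

  H5-layering : Layering (H5 m n) (suc m₂) 3
  H5-layering = record
    { Below = Below ; Below? = Below? ; Below-mono = Below-mono
    ; base = u zero zero , tt ; base-below = z≤n
    ; gate = gate ; gate-cut = gate-cut₅
    ; witness = witness ; witness-between = witness-between
    ; no-SP-contains-all = λ i M gate∈ w∈ →
        SP-triangle-free M gate∈ (w∈ zero) (w∈ (suc (suc zero)))
          (inj₁ (gate-to-gap i zero)) (inj₂ (inj₁ (vv i zero (suc zero) refl refl)))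
          (inj₁ (gate-to-gap i (suc zero)))
    }

lemma4p2 : (m n : ℕ) → 2 ≤ m → 3 ≤ n →
    InspcAtLeast (H1 m n) ⌈ suc m /2⌉
    × InspcAtLeast (H2 m n) ⌈ suc m /2⌉
    × InspcAtLeast (H3 m n) m
    × InsppAtLeast (H4 m n) m
    × InsppAtLeast (H5 m n) m
lemma4p2 (suc (suc m₂)) (suc (suc (suc n₂))) (s≤s (s≤s z≤n)) (s≤s (s≤s (s≤s z≤n))) =
  H1-bound.bound m₂ n₂ , H2-bound.bound m₂ n₂ , H3-bound.bound m₂ n₂ ,
  layering-count (H45-layers.H4-layering m₂ n₂) , layering-count (H45-layers.H5-layering m₂ n₂)
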